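{- The complete graph $K_4$ is P1-win, and the complete graph $K_5$ is P2-win.
   Context: Trail Trap on a finite simple undirected graph $G$: Player 1 (P1) chooses a vertex, places a token on it and moves it along an incident edge $e$ to the other endpoint. Player 2 (P2) then places their own token on any vertex and moves it along an incident edge $f \neq e$. Thereafter the players alternate, starting with P1, each moving their own token from its current vertex along an unused edge (an edge not previously traversed, in either direction, by either player) to the adjacent vertex; vertices may be revisited and the two tokens may share a vertex. The first player unable to move loses. $G$ is P1-win if P1 has a winning strategy, and P2-win otherwise. -}

module Defs where

open import Data.Nat using (ℕ)
open import Data.Fin using (Fin)
open import Data.Product using (Σ; ∃; ∃-syntax; _×_; _,_)
open import Data.Sum using (_⊎_)
open import Data.List using (List; []; _∷_)
open import Data.List.Relation.Unary.Any using (Any)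
open import Relation.Nullary using (¬_)
open import Relation.Binary.PropositionalEquality using (_≡_; _≢_)

record Graph : Set₁ where
  field
    n      : ℕ
    Adj    : Fin n → Fin n → Set
    sym    : ∀ {x y} → Adj x y → Adj y x
    irrefl : ∀ {x} → ¬ Adj x x

K : ℕ → Graph
K m = record
  { n = m
  ; Adj = λ x y → x ≢ y
  ; sym = λ x≢y y≡x → x≢y (Relation.Binary.PropositionalEquality.sym y≡x)
  ; irrefl = λ x≢x → x≢x Relation.Binary.PropositionalEquality.refl
  }

module Game (G : Graph) where
  open Graph G

  V : Set
  V = Fin n

  -- a traversal of an edge, recorded as an ordered pair of endpoints
  Step : Set
  Step = V × V

  SameEdge : Step → Step → Set
  SameEdge (a , b) (x , y) = (a ≡ x × b ≡ y) ⊎ (a ≡ y × b ≡ x)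

  Used : List Step → V → V → Set
  Used hist x y = Any (λ s → SameEdge s (x , y)) hist

  Legal : List Step → V → V → Set
  Legal hist x y = Adj x y × ¬ Used hist x y

  -- Position: history of used edges, token of player to move at x,
  -- token of the other player at y.
  -- Lose hist x y : every legal move of the player to move leads to a
  --                 position where the opponent has a winning strategy
  --                 (in particular, having no legal move is losing).
  -- The game is finite, so inductive (well-founded) strategies suffice.
  data Win  (hist : List Step) (x y : V) : Set
  data Lose (hist : List Step) (x y : V) : Set

  data Win hist x y where
    move : (x' : V) → Legal hist x x' → Lose ((x , x') ∷ hist) y x' → Win hist x y

  data Lose hist x y where
    allMoves : (∀ x' → Legal hist x x' → Win ((x , x') ∷ hist) y x') → Lose hist x y

  -- P1 picks v and moves along e = {v,u}; P2 then picks any w and moves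
  -- along an edge f = {w,w'} ≠ e; afterwards P1 moves from u, P2's token at w'.
  P1-win : Set
  P1-win =
    ∃[ v ] ∃[ u ] (Adj v u ×
      (∀ w w' → Adj w w' → ¬ SameEdge (w , w') (v , u) →
        Win ((w , w') ∷ (v , u) ∷ []) u w'))

  P2-win : Set
  P2-win = ¬ P1-win

P1-win : Graph → Set
P1-win G = Game.P1-win G

P2-win : Graph → Set
P2-win G = Game.P2-win G

module Submission where

open import Defs
open import Data.Product using (∃; ∃₂; _×_; _,_; curry)
open import Data.Nat using (ℕ; zero; suc)
open import Data.Fin using (Fin; zero; suc)
open import Data.Fin.Properties using (_≟_)
open import Data.List using (List; []; _∷_; allFin)
open import Data.List.Relation.Unary.All using (All; []; _∷_; lookup)
open import Data.List.Relation.Unary.Any using (any?)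
open import Data.List.Membership.Propositional.Properties using (∈-allFin)
open import Data.Maybe as Maybe using (Maybe; just; nothing; from-just)
open import Data.Sum as Sum using (_⊎_; inj₁; inj₂)
open import Data.Empty using (⊥; ⊥-elim)
open import Function using (_∘_; const)
open import Relation.Nullary using (¬_; Dec; yes; no)
open import Relation.Nullary.Decidable using (_×-dec_; _⊎-dec_; ¬?)
open import Relation.Binary.Definitions using (Decidable)

-- The game trees of K₄ and K₅ are small enough to search exhaustively, and the
-- search returns the Win/Lose derivations it finds. On K₄, P1 opening along the
-- edge 01 wins against every reply; on K₅, every opening has a reply after which
-- P1, to move, is in a losing position.

all-Fin? : ∀ {n} {P : Fin n → Set} → (∀ i → Maybe (P i)) → Maybe (∀ i → P i)
all-Fin? {zero}  f = just λ ()
all-Fin? {suc n} f with f zero | all-Fin? (f ∘ suc)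
... | just p | just ps = just λ { zero → p ; (suc i) → ps i }
... | _      | _       = nothing

any-Fin? : ∀ {n} {P : Fin n → Set} → (∀ i → Maybe (P i)) → Maybe (∃ P)
any-Fin? {zero}  f = nothing
any-Fin? {suc n} f with f zero
... | just p  = just (zero , p)
... | nothing = Maybe.map (λ { (i , p) → suc i , p }) (any-Fin? (f ∘ suc))

implication? : {A B : Set} → Dec A → Maybe B → Maybe (A → B)
implication? (yes _) b = Maybe.map const b
implication? (no ¬a) _ = just (⊥-elim ∘ ¬a)

conjunction? : {A B : Set} → Dec A → Maybe B → Maybe (A × B)
conjunction? (yes a) b = Maybe.map (a ,_) b
conjunction? (no _)  _ = nothing

module Search (G : Graph) (adj? : Decidable (Graph.Adj G)) where
  open Graph G
  open Game G hiding (P1-win; P2-win)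

  sameEdge? : Decidable SameEdge
  sameEdge? (a , b) (x , y) = ((a ≟ x) ×-dec (b ≟ y)) ⊎-dec ((a ≟ y) ×-dec (b ≟ x))

  legal? : ∀ hist x y → Dec (Legal hist x y)
  legal? hist x y = adj? x y ×-dec ¬? (any? (λ s → sameEdge? s (x , y)) hist)

  ¬Win×Lose : ∀ {hist x y} → Win hist x y → Lose hist x y → ⊥
  ¬Win×Lose (move x' legal lose) (allMoves replies) = ¬Win×Lose (replies x' legal) lose

  Outcome : List Step → V → V → Set
  Outcome hist x y = Win hist x y ⊎ Lose hist x y

  NonWinningMove : List Step → V → V → V → Set
  NonWinningMove hist x y x' = Legal hist x x' → Win ((x , x') ∷ hist) y x'

  -- Fuel bounds the number of further moves searched; nothing means it ran out.
  outcome? : ℕ → ∀ hist x y → Maybe (Outcome hist x y)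
  outcome? zero    hist x y = nothing
  outcome? (suc k) hist x y = Maybe.map (Sum.map₂ allNonWinning) (scan (allFin n))
    where
    allNonWinning : All (NonWinningMove hist x y) (allFin n) → Lose hist x y
    allNonWinning nonWinning = allMoves λ x' → lookup nonWinning (∈-allFin x')

    scan : ∀ cs → Maybe (Win hist x y ⊎ All (NonWinningMove hist x y) cs)
    scan [] = just (inj₂ [])
    scan (c ∷ cs) with legal? hist x c
    ... | no illegal = Maybe.map (Sum.map₂ ((⊥-elim ∘ illegal) ∷_)) (scan cs)
    ... | yes legal with outcome? k ((x , c) ∷ hist) y c
    ...   | nothing         = nothing
    ...   | just (inj₂ lose) = just (inj₁ (move c legal lose))
    ...   | just (inj₁ win)  = Maybe.map (Sum.map₂ (const win ∷_)) (scan cs)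

  win? : ℕ → ∀ hist x y → Maybe (Win hist x y)
  win? k hist x y = Maybe.maybe Sum.[ just , const nothing ] nothing (outcome? k hist x y)

  lose? : ℕ → ∀ hist x y → Maybe (Lose hist x y)
  lose? k hist x y = Maybe.maybe Sum.[ const nothing , just ] nothing (outcome? k hist x y)

  Reply : V → V → V → V → Set
  Reply v u w w' = Adj w w' × ¬ SameEdge (w , w') (v , u)

  reply? : ∀ v u w w' → Dec (Reply v u w w')
  reply? v u w w' = adj? w w' ×-dec ¬? (sameEdge? (w , w') (v , u))

  WinningOpening : V → V → Set
  WinningOpening v u = ∀ w w' → Reply v u w w' → Win ((w , w') ∷ (v , u) ∷ []) u w'

  winningOpening? : ℕ → ∀ v u → Maybe (WinningOpening v u)
  winningOpening? k v u = all-Fin? λ w → all-Fin? λ w' →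
    implication? (reply? v u w w') (win? k ((w , w') ∷ (v , u) ∷ []) u w')

  Refutation : V → V → Set
  Refutation v u = ∃₂ λ w w' → Reply v u w w' × Lose ((w , w') ∷ (v , u) ∷ []) u w'

  refutation? : ℕ → ∀ v u → Maybe (Adj v u → Refutation v u)
  refutation? k v u = implication? (adj? v u) (any-Fin? λ w → any-Fin? λ w' →
    conjunction? (reply? v u w w') (lose? k ((w , w') ∷ (v , u) ∷ []) u w'))

  P1-win-by-opening : ∀ {v u} → Adj v u → WinningOpening v u → P1-win G
  P1-win-by-opening adj wins = _ , _ , adj , λ w w' → curry (wins w w')

  P2-win-by-refutations : (∀ v u → Adj v u → Refutation v u) → P2-win G
  P2-win-by-refutations refute (v , u , adj , wins) with refute v u adj
  ... | w , w' , (adj' , fresh) , lose = ¬Win×Lose (wins w w' adj' fresh) lose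

complete? : ∀ m → Decidable (Graph.Adj (K m))
complete? m x y = ¬? (x ≟ y)

module K₄ = Search (K 4) (complete? 4)
module K₅ = Search (K 5) (complete? 5)

-- A play on K₅ uses at most its 10 edges, so this fuel never runs out.
fuel : ℕ
fuel = 10

K₄-P1-win : P1-win (K 4)
K₄-P1-win = K₄.P1-win-by-opening (λ ()) (from-just (K₄.winningOpening? fuel zero (suc zero)))

K₅-P2-win : P2-win (K 5)
K₅-P2-win = K₅.P2-win-by-refutations (from-just (all-Fin? λ v → all-Fin? λ u → K₅.refutation? fuel v u))

proposition3p1 : P1-win (K 4) × P2-win (K 5)
proposition3p1 = K₄-P1-win , K₅-P2-win
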